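{- Let $c=s_1s_2\cdots s_{n-1}$ and let $\omega\in\Omega^{NC}_c$. Then for blocks $B_{[i,j]},B_{[k,l]}$ of $\omega$, $B_{[i,j]}\preceq B_{[k,l]}$ in $\omega$ if and only if $[i,j]\subseteq[k,l]$.
   Context: $S_n$ is generated by $s_i=(i,i+1)$. For $c=s_1s_2\cdots s_{n-1}$, every $i\in\{2,\ldots,n-1\}$ is lower-barred, and the cycle of $c$ is $1,2,\ldots,n$ clockwise. A pre-order on $[n]$ is a reflexive transitive relation; blocks are classes of $i\equiv j\iff i\preceq j\preceq i$; $B_{[i,j]}$ denotes the block with minimum $i$ and maximum $j$; blocks overlap if their intervals intersect. $\omega\in\Omega$ means (P1) overlapping blocks comparable and (P2) every cover between blocks is between overlapping blocks. $\omega\in\Omega^{NC}_c$ means moreover: (1) the blocks form a noncrossing partition of the points $1,\ldots,n$ placed in order on a circle (convex hulls pairwise disjoint), and (2) for distinct overlapping blocks $B,B'$ and $x\in B'$ with $\min B<x<\max B$: if $x$ is lower-barred then $B\succ B'$ (and if upper-barred then $B\prec B'$). -}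

module Defs where

open import Level using (Level; suc; _⊔_)
open import Data.Nat using (ℕ)
import Data.Nat as ℕ
open import Data.Fin using (Fin; toℕ; _≤_; _<_)
open import Data.Product using (_×_; Σ; ∃; ∃-syntax)
open import Data.Sum using (_⊎_)
open import Data.Empty using (⊥)
open import Relation.Nullary using (¬_)

-- Points of [n] = {1,…,n} are represented by Fin n (point p ↦ toℕ p + 1);
-- the order on Fin n is the usual order of [n].

record PreOrder (n : ℕ) : Set₁ where
  field
    _≼_   : Fin n → Fin n → Set
    refl  : ∀ x → x ≼ x
    trans : ∀ {x y z} → x ≼ y → y ≼ z → x ≼ z

module _ {n : ℕ} (ω : PreOrder n) where
  open PreOrder ω

  SameBlock : Fin n → Fin n → Set
  SameBlock x y = (x ≼ y) × (y ≼ x)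

  IsBlockMin : Fin n → Fin n → Set
  IsBlockMin x m = SameBlock m x × (∀ y → SameBlock y x → m ≤ y)

  IsBlockMax : Fin n → Fin n → Set
  IsBlockMax x M = SameBlock M x × (∀ y → SameBlock y x → y ≤ M)

  IsBlockInterval : Fin n → Fin n → Fin n → Set
  IsBlockInterval x i j = IsBlockMin x i × IsBlockMax x j

  Overlap : Fin n → Fin n → Set
  Overlap x y = ∃[ i ] ∃[ j ] ∃[ k ] ∃[ l ]
    (IsBlockInterval x i j × IsBlockInterval y k l × i ≤ l × k ≤ j)

  _≺_ : Fin n → Fin n → Set
  x ≺ y = (x ≼ y) × ¬ (y ≼ x)

  Covers : Fin n → Fin n → Set
  Covers x y = (x ≺ y) × (∀ z → ¬ ((x ≺ z) × (z ≺ y)))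

  P1 : Set
  P1 = ∀ x y → Overlap x y → (x ≼ y) ⊎ (y ≼ x)

  P2 : Set
  P2 = ∀ x y → Covers x y → Overlap x y

  InΩ : Set
  InΩ = P1 × P2

  Noncrossing : Set
  Noncrossing = ∀ a b c d → a < b → b < c → c < d →
    SameBlock a c → SameBlock b d → SameBlock a b

  BarCondition : (Fin n → Set) → (Fin n → Set) → Set
  BarCondition lower upper = ∀ b x → ¬ SameBlock b x → Overlap b x →
    ∀ i j → IsBlockInterval b i j → i < x → x < j →
    (lower x → x ≺ b) × (upper x → b ≺ x)

  -- ω ∈ Ω^NC_c for a Coxeter element whose barring is given by lower/upper
  InΩNC : (Fin n → Set) → (Fin n → Set) → Set
  InΩNC lower upper = InΩ × Noncrossing × BarCondition lower upper

-- Barring for c = s₁ s₂ ⋯ s_{n-1}: every i ∈ {2,…,n-1} is lower-barred,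
-- nothing is upper-barred.  (In 0-based Fin n: 1 ≤ toℕ x ≤ n-2.)
LowerBarred-c : (n : ℕ) → Fin n → Set
LowerBarred-c n x = (1 ℕ.≤ toℕ x) × (toℕ x ℕ.+ 2 ℕ.≤ n)

UpperBarred-c : (n : ℕ) → Fin n → Set
UpperBarred-c n x = ⊥

InΩNC-c : {n : ℕ} → PreOrder n → Set
InΩNC-c {n} ω = InΩNC ω (LowerBarred-c n) (UpperBarred-c n)

module Submission where

-- For c = s₁⋯s_{n-1} every point strictly inside [1,n] is lower-barred, so
-- the bar condition says: if a point p of a block B' lies strictly inside the
-- interval of an overlapping block B ≠ B', then B' ≺ B.
--
-- (⇐) If [i,j] ⊆ [k,l] and the blocks differ, then i lies strictly inside
--     (k,l), so the bar condition gives B_[i,j] ≺ B_[k,l].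
-- (⇒) A strict relation B ≺ B' between OVERLAPPING blocks forces the interval
--     of B inside that of B' (a point of B' in [i,j] would give B' ≼ B).
--     By (P2) every cover is between overlapping blocks, and in a finite
--     preorder with decidable order every relation x ≼ y is a chain of
--     covers; since "lies within the span of" is transitive, x ≼ y implies
--     nesting.  Decidability of ≼ is not assumed: as the conclusion is a
--     decidable statement about Fin n, it may be obtained by double negation.
--
-- Only (P2) and the bar condition are needed; (P1) and noncrossingness are not.

open import Defs
open import Data.Nat using (ℕ)
open import Data.Fin using (Fin; _≤_)
open import Data.Product using (_×_)
open import Function.Bundles using (_⇔_)

import Data.Nat as ℕ
import Data.Nat.Properties as ℕ
open import Data.Fin using (toℕ; _<_; zero; suc; _≟_)
open import Data.Fin.Properties using (≤-refl; ≤-trans; ≤∧≢⇒<; _≤?_; any?; toℕ<n)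
open import Data.Fin.Induction using (spo-wellFounded; spo-noetherian)
open import Data.Product using (_,_; proj₁; proj₂; ∃)
open import Data.Empty using (⊥)
open import Function.Base using (_∘_; flip)
open import Function.Bundles using (mk⇔)
open import Induction.WellFounded using (WellFounded; Acc; acc)
open import Relation.Binary.Structures using (IsEquivalence; IsStrictPartialOrder)
open import Relation.Binary.PropositionalEquality using (refl; sym; subst)
open import Relation.Nullary using (¬_; Dec; yes; no)
open import Relation.Nullary.Decidable using (_×-dec_; ¬?; decidable-stable; ¬¬-excluded-middle)

¬¬-shift : ∀ {m} (Q : Fin m → Set) → (∀ a → ¬ ¬ Q a) → ¬ ¬ (∀ a → Q a)
¬¬-shift {ℕ.zero}  Q h k = k (λ ())
¬¬-shift {ℕ.suc m} Q h k =
  h zero λ q₀ → ¬¬-shift (Q ∘ suc) (h ∘ suc) λ qs → k λ { zero → q₀ ; (suc a) → qs a }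

¬¬-decidable : ∀ {m} (R : Fin m → Fin m → Set) → ¬ ¬ (∀ a b → Dec (R a b))
¬¬-decidable R = ¬¬-shift _ λ a → ¬¬-shift _ λ b → ¬¬-excluded-middle

-- A point strictly between two points of [n] is not an endpoint of [n],
-- hence lower-barred for c = s₁⋯s_{n-1}.
interior-lowerBarred : ∀ {n} {i p j : Fin n} → i < p → p < j → LowerBarred-c n p
interior-lowerBarred {n} {i} {p} {j} i<p p<j =
  ℕ.≤-trans (ℕ.s≤s ℕ.z≤n) i<p ,
  subst (ℕ._≤ n) (ℕ.+-comm 2 (toℕ p)) (ℕ.≤-trans (ℕ.s≤s p<j) (toℕ<n j))

module Blocks {n : ℕ} (ω : PreOrder n) where
  open PreOrder ω renaming (refl to ≼-refl; trans to ≼-trans)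

  _∼_ : Fin n → Fin n → Set
  _∼_ = SameBlock ω

  _⊏_ : Fin n → Fin n → Set
  _⊏_ = _≺_ ω

  ∼-isEquivalence : IsEquivalence _∼_
  ∼-isEquivalence = record
    { refl  = λ {x} → ≼-refl x , ≼-refl x
    ; sym   = λ (x≼y , y≼x) → y≼x , x≼y
    ; trans = λ (x≼y , y≼x) (y≼z , z≼y) → ≼-trans x≼y y≼z , ≼-trans z≼y y≼x
    }

  open IsEquivalence ∼-isEquivalence public using () renaming (sym to ∼-sym; trans to ∼-trans)

  ≺-isStrictPartialOrder : IsStrictPartialOrder _∼_ _⊏_
  ≺-isStrictPartialOrder = record
    { isEquivalence = ∼-isEquivalence
    ; irrefl   = λ (_ , y≼x) (_ , y⋠x) → y⋠x y≼x
    ; trans    = λ (x≼y , y⋠x) (y≼z , _) →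
                   ≼-trans x≼y y≼z , λ z≼x → y⋠x (≼-trans y≼z z≼x)
    ; <-resp-≈ = (λ (y≼z , _) (x≼y , y⋠x) → ≼-trans x≼y y≼z , λ z≼x → y⋠x (≼-trans y≼z z≼x))
               , (λ (_ , z≼y) (y≼x , x⋠y) → ≼-trans z≼y y≼x , λ x≼z → x⋠y (≼-trans x≼z z≼y))
    }

  ⊏-wellFounded : WellFounded _⊏_
  ⊏-wellFounded = spo-wellFounded ≺-isStrictPartialOrder

  ⊏-noetherian : WellFounded (flip _⊏_)
  ⊏-noetherian = spo-noetherian ≺-isStrictPartialOrder

  module _ {x i j : Fin n} (I : IsBlockInterval ω x i j) where
    min∼ : i ∼ x
    min∼ = proj₁ (proj₁ I)

    max∼ : j ∼ x
    max∼ = proj₁ (proj₂ I)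

    min≤ : ∀ {w} → w ∼ x → i ≤ w
    min≤ = proj₂ (proj₁ I) _

    ≤max : ∀ {w} → w ∼ x → w ≤ j
    ≤max = proj₂ (proj₂ I) _

    min≤max : i ≤ j
    min≤max = min≤ max∼

  interval-transfer : ∀ {x y i j} → x ∼ y → IsBlockInterval ω y i j → IsBlockInterval ω x i j
  interval-transfer x∼y I =
    (∼-trans (min∼ I) (∼-sym x∼y) , λ _ w∼x → min≤ I (∼-trans w∼x x∼y)) ,
    (∼-trans (max∼ I) (∼-sym x∼y) , λ _ w∼x → ≤max I (∼-trans w∼x x∼y))

  overlap-transferʳ : ∀ {x y p} → p ∼ y → Overlap ω x y → Overlap ω x p
  overlap-transferʳ p∼y (i , j , k , l , Ix , Iy , i≤l , k≤j) =
    i , j , k , l , Ix , interval-transfer p∼y Iy , i≤l , k≤j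

  WithinSpan : Fin n → Fin n → Set
  WithinSpan x y = ∀ {w} → w ∼ x →
    (∃ λ a → a ∼ y × a ≤ w) × (∃ λ b → b ∼ y × w ≤ b)

  within-same : ∀ {x y} → x ∼ y → WithinSpan x y
  within-same x∼y {w} w∼x = (w , w∼y , ≤-refl) , (w , w∼y , ≤-refl)
    where w∼y = ∼-trans w∼x x∼y

  within-trans : ∀ {x y z} → WithinSpan x y → WithinSpan y z → WithinSpan x z
  within-trans x⊆y y⊆z w∼x =
    let ((a , a∼y , a≤w) , (b , b∼y , w≤b)) = x⊆y w∼x
        ((a′ , a′∼z , a′≤a) , _) = y⊆z a∼y
        (_ , (b′ , b′∼z , b≤b′)) = y⊆z b∼y
    in (a′ , a′∼z , ≤-trans a′≤a a≤w) , (b′ , b′∼z , ≤-trans w≤b b≤b′)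

  nested⇒within : ∀ {x y i j k l} → IsBlockInterval ω x i j → IsBlockInterval ω y k l →
    k ≤ i → j ≤ l → WithinSpan x y
  nested⇒within Ix Iy k≤i j≤l w∼x =
    (_ , min∼ Iy , ≤-trans k≤i (min≤ Ix w∼x)) , (_ , max∼ Iy , ≤-trans (≤max Ix w∼x) j≤l)

  within⇒nested : ∀ {x y i j k l} → IsBlockInterval ω x i j → IsBlockInterval ω y k l →
    WithinSpan x y → (k ≤ i) × (j ≤ l)
  within⇒nested Ix Iy x⊆y =
    let ((a , a∼y , a≤i) , _) = x⊆y (min∼ Ix)
        (_ , (b , b∼y , j≤b)) = x⊆y (max∼ Ix)
    in ≤-trans (min≤ Iy a∼y) a≤i , ≤-trans j≤b (≤max Iy b∼y)

  -- The proof is a lexicographic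
  -- induction: upwards from x (noetherian ⊏) and downwards to y (well-founded ⊏);
  -- a non-cover x ⊏ y splits at some x ⊏ z ⊏ y.  The accessibility proofs are
  -- passed to 'step' so that the recursive calls are structurally smaller.
  cover-induction : (∀ a b → Dec (a ≼ b)) → (R : Fin n → Fin n → Set) →
    (∀ {x y} → x ∼ y → R x y) → (∀ {x y z} → R x y → R y z → R x z) →
    (∀ {x y} → Covers ω x y → R x y) → ∀ {x y} → x ≼ y → R x y
  cover-induction _≼?_ R R-same R-trans R-cover {x} {y} =
    go (⊏-noetherian x) (⊏-wellFounded y)
    where
      between? : ∀ x y → Dec (∃ λ z → (x ⊏ z) × (z ⊏ y))
      between? x y = any? λ z → (x ≼? z ×-dec ¬? (z ≼? x)) ×-dec (z ≼? y ×-dec ¬? (y ≼? z))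

      go : ∀ {x y} → Acc (flip _⊏_) x → Acc _⊏_ y → x ≼ y → R x y
      go {x} {y} acc-x acc-y x≼y = step acc-x acc-y (y ≼? x) (between? x y)
        where
          step : Acc (flip _⊏_) x → Acc _⊏_ y →
            Dec (y ≼ x) → Dec (∃ λ z → (x ⊏ z) × (z ⊏ y)) → R x y
          step _ _ (yes y≼x) _ = R-same (x≼y , y≼x)
          step acc-x@(acc above) (acc below) (no _) (yes (z , x⊏z , z⊏y)) =
            R-trans (go acc-x (below z⊏y) (proj₁ x⊏z))
                    (go (above x⊏z) (⊏-wellFounded y) (proj₁ z⊏y))
          step _ _ (no y⋠x) (no none) = R-cover ((x≼y , y⋠x) , λ z z-between → none (z , z-between))

module Nesting {n : ℕ} (ω : PreOrder n) {upper : Fin n → Set}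
  (bar : BarCondition ω (LowerBarred-c n) upper) where
  open PreOrder ω renaming (trans to ≼-trans)
  open Blocks ω

  interior-below : ∀ {b p i j} → ¬ (b ∼ p) → Overlap ω b p →
    IsBlockInterval ω b i j → i < p → p < j → p ⊏ b
  interior-below b≁p b≬p I i<p p<j =
    proj₁ (bar _ _ b≁p b≬p _ _ I i<p p<j) (interior-lowerBarred i<p p<j)

  nested⇒≼ : ∀ {x y i j k l} → IsBlockInterval ω x i j → IsBlockInterval ω y k l →
    k ≤ i → j ≤ l → x ≼ y
  nested⇒≼ {x} {y} {i} {j} {k} {l} Ix Iy k≤i j≤l with k ≟ i | i ≟ l
  ... | yes refl | _        = ≼-trans (proj₂ (min∼ Ix)) (proj₁ (min∼ Iy))
  ... | no _     | yes refl = ≼-trans (proj₂ (min∼ Ix)) (proj₁ (max∼ Iy))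
  ... | no k≢i   | no i≢l   = ≼-trans (proj₂ (min∼ Ix)) (proj₁ (interior-below y≁i y≬i Iy k<i i<l))
    where
      k<i : k < i
      k<i = ≤∧≢⇒< k≤i k≢i
      i<l : i < l
      i<l = ≤∧≢⇒< (≤-trans (min≤max Ix) j≤l) i≢l
      -- if i were in the block of y, so would be k < i, contradicting minimality of i
      y≁i : ¬ (y ∼ i)
      y≁i y∼i = ℕ.<⇒≱ k<i (min≤ Ix (∼-trans (min∼ Iy) (∼-trans y∼i (min∼ Ix))))
      y≬i : Overlap ω y i
      y≬i = k , l , i , j , Iy , interval-transfer (min∼ Ix) Ix ,
                ≤-trans k≤i (min≤max Ix) , ℕ.<⇒≤ i<l

  -- No point of a strictly larger overlapping block lies in [i,j]: an
  -- endpoint would place it in the block of x, and an interior point would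
  -- place it in a smaller block by the bar condition.
  larger-block-avoids : ∀ {x y i j p} → x ⊏ y → Overlap ω x y → IsBlockInterval ω x i j →
    p ∼ y → i ≤ p → p ≤ j → ⊥
  larger-block-avoids {x} {y} {i} {j} {p} (_ , y⋠x) x≬y Ix p∼y i≤p p≤j =
    y⋠x (≼-trans (proj₂ p∼y) p≼x)
    where
      p≼x : p ≼ x
      p≼x with p ≟ i | p ≟ j
      ... | yes p≡i | _       = subst (_≼ x) (sym p≡i) (proj₁ (min∼ Ix))
      ... | no _    | yes p≡j = subst (_≼ x) (sym p≡j) (proj₁ (max∼ Ix))
      ... | no p≢i  | no p≢j  =
        proj₁ (interior-below x≁p (overlap-transferʳ p∼y x≬y) Ix
                 (≤∧≢⇒< i≤p (p≢i ∘ sym)) (≤∧≢⇒< p≤j p≢j))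
        where
          x≁p : ¬ (x ∼ p)
          x≁p x∼p = y⋠x (≼-trans (proj₂ p∼y) (proj₂ x∼p))

  strict-overlap⇒within : ∀ {x y} → x ⊏ y → Overlap ω x y → WithinSpan x y
  strict-overlap⇒within x⊏y x≬y@(i , j , k , l , Ix , Iy , i≤l , k≤j) =
    nested⇒within Ix Iy k≤i j≤l
    where
      k≤i : k ≤ i
      k≤i = decidable-stable (k ≤? i) λ k≰i →
        larger-block-avoids x⊏y x≬y Ix (min∼ Iy) (ℕ.<⇒≤ (ℕ.≰⇒> k≰i)) k≤j
      j≤l : j ≤ l
      j≤l = decidable-stable (j ≤? l) λ j≰l →
        larger-block-avoids x⊏y x≬y Ix (max∼ Iy) i≤l (ℕ.<⇒≤ (ℕ.≰⇒> j≰l))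

  -- (⇒) By (P2) every cover is a strict relation between overlapping blocks,
  -- so induction along covers gives nesting once ≼ is decidable; as nesting
  -- is decidable, decidability of ≼ is available by double negation.
  ≼⇒nested : P2 ω → ∀ {x y i j k l} → IsBlockInterval ω x i j → IsBlockInterval ω y k l →
    x ≼ y → (k ≤ i) × (j ≤ l)
  ≼⇒nested p2 {x} {y} {i} {j} {k} {l} Ix Iy x≼y =
    decidable-stable (k ≤? i ×-dec j ≤? l) λ not-nested →
      ¬¬-decidable _≼_ λ _≼?_ → not-nested (within⇒nested Ix Iy (x⊆y _≼?_))
    where
      x⊆y : (∀ a b → Dec (a ≼ b)) → WithinSpan x y
      x⊆y _≼?_ = cover-induction _≼?_ WithinSpan within-same within-trans
        (λ x⋖y → strict-overlap⇒within (proj₁ x⋖y) (p2 _ _ x⋖y)) x≼y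

corollary5p5 : (n : ℕ) (ω : PreOrder n) → InΩNC-c ω →
    (x y i j k l : Fin n) →
    IsBlockInterval ω x i j → IsBlockInterval ω y k l →
    (PreOrder._≼_ ω x y ⇔ ((k ≤ i) × (j ≤ l)))
corollary5p5 n ω ((_ , p2) , _ , bar) x y i j k l Ix Iy =
  mk⇔ (≼⇒nested p2 Ix Iy) (λ (k≤i , j≤l) → nested⇒≼ Ix Iy k≤i j≤l)
  where open Nesting ω bar
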